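{- Let $m$ and $n$ be positive integers. For every $\mathbf{z}\in\mathcal{V}_{m,n}$, the interval $[\mathbf{0},\mathbf{z}]$ in $\mathcal{V}_{m,n}$ is a shellable poset.
   Context: $\mathcal{V}_{m,n}$ is the poset whose ground set is $\{(\alpha_1,\dots,\alpha_n)\in\mathbb{N}_0^n:\alpha_1+\dots+\alpha_n\equiv 0\pmod m\}$, ordered coordinatewise ($\mathbf{a}\le\mathbf{b}$ iff $\alpha_i\le\beta_i$ for all $i$); $\mathbf{0}$ is the zero vector. A bounded poset is shellable if its maximal chains admit an order such that whenever $c'$ precedes $c$ there is $c^*$ preceding $c$ with $c\cap c^*\supseteq c\cap c'$ and $|c\,\Delta\,c^*|=2$. -}

module Defs where

open import Data.Nat using (ℕ; _≤_)
open import Data.Nat.Divisibility using (_∣_)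
open import Data.Vec using (Vec; sum; replicate)
open import Data.Vec.Relation.Binary.Pointwise.Inductive using (Pointwise)
open import Data.List using (List; length; filter; _++_; lookup)
open import Data.List.Membership.Propositional using (_∈_; _∉_)
open import Data.List.Relation.Unary.All using (All)
open import Data.List.Relation.Unary.Unique.Propositional using (Unique)
open import Data.List.Relation.Unary.Linked using (Linked)
open import Data.List.Membership.DecPropositional using () renaming (_∉?_ to _∉?_)
open import Data.Fin using (Fin) renaming (_<_ to _<ᶠ_)
open import Data.Product using (Σ; _×_; ∃)
open import Relation.Binary.PropositionalEquality using (_≡_)
open import Relation.Binary.Definitions using (DecidableEquality)
open import Relation.Nullary using (¬_)
open import Level using (Level; suc; _⊔_)

module Shelling {a ℓ₁ ℓ₂} {A : Set a} (_≟_ : DecidableEquality A)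
                (Elem : A → Set ℓ₁) (_≼_ : A → A → Set ℓ₂) where

  _≺_ : A → A → Set (a ⊔ ℓ₂)
  x ≺ y = (x ≼ y) × ¬ (x ≡ y)

  IsChain : List A → Set (a ⊔ ℓ₁ ⊔ ℓ₂)
  IsChain c = All Elem c × Linked _≺_ c

  IsMaxChain : List A → Set (a ⊔ ℓ₁ ⊔ ℓ₂)
  IsMaxChain c = IsChain c × (∀ (c′ : List A) → IsChain c′ → (∀ {x} → x ∈ c → x ∈ c′) → ∀ {x} → x ∈ c′ → x ∈ c)

  symDiff : List A → List A → List A
  symDiff c d = filter (λ x → _∉?_ _≟_ x d) c ++ filter (λ x → _∉?_ _≟_ x c) d

  Shellable : Set (a ⊔ ℓ₁ ⊔ ℓ₂)
  Shellable =
    Σ (List (List A)) λ L →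
      Unique L ×
      All IsMaxChain L ×
      (∀ c → IsMaxChain c → c ∈ L) ×
      (∀ (i j : Fin (length L)) → i <ᶠ j →
         ∃ λ (k : Fin (length L)) → k <ᶠ j ×
           (∀ {x} → x ∈ lookup L j → x ∈ lookup L i → x ∈ lookup L k) ×
           length (symDiff (lookup L j) (lookup L k)) ≡ 2)

_≤v_ : ∀ {n} → Vec ℕ n → Vec ℕ n → Set
_≤v_ = Pointwise _≤_

InV : (m n : ℕ) → Vec ℕ n → Set
InV m n a = m ∣ sum a

𝟎 : ∀ n → Vec ℕ n
𝟎 n = replicate n 0

InInterval : (m n : ℕ) → Vec ℕ n → Vec ℕ n → Set
InInterval m n z a = InV m n a × (𝟎 n ≤v a) × (a ≤v z)

module Submission where

-- Sums of elements of V_{m,n} are multiples of m, so the maximal chains of [0, z] are the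
-- sequences 0 = a₀ < a₁ < ⋯ < a_K = z in which every step raises the coordinate sum by m.
-- Order them lexicographically, comparing elements by the reverse lexicographic order of
-- their coordinates. If c′ precedes c, let b′ ≠ b be their first different elements and i
-- the first coordinate where these differ, so bᵢ < b′ᵢ. Climbing c from b, coordinate i
-- stays below b′ᵢ until the first step u < v that raises some coordinate j ≤ i (it exists
-- since zᵢ ≥ b′ᵢ). Moving one unit of u into coordinate j yields an earlier u′ between the
-- neighbours of u, and replacing u by u′ gives an earlier maximal chain c* with
-- |c Δ c*| = 2. As uᵢ < b′ᵢ, u is not on c′, so c ∩ c′ ⊆ c*.

open import Defs
open import Function using (_∘_; flip)
open import Data.Product using (∃-syntax; _×_; _,_; proj₁; proj₂)
open import Data.Sum using (_⊎_; inj₁; inj₂; [_,_]′)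
import Data.Sum as Sum
open import Data.Nat
  using (ℕ; zero; suc; _+_; _*_; _≤_; _<_; _>_; z≤n; s≤s; _≤?_; _<?_; >-nonZero)
open import Data.Nat.Properties
open import Data.Nat.Divisibility using (_∣_; divides; ∣m∣n⇒∣m+n; ∣-refl)
open import Data.Fin using (Fin; zero; suc) renaming (_<_ to _<ᶠ_)
import Data.Fin.Properties as Fin
open import Data.Vec using (Vec; []; _∷_; sum; lookup)
open import Data.Vec.Properties using (≡-dec)
import Data.Vec.Relation.Binary.Pointwise.Inductive as PW
open PW using ([]; _∷_)
import Data.Vec.Relation.Binary.Lex.Strict as VecLex
open import Data.List
  using (List; []; _∷_; _++_; [_]; length; filter; map; concatMap; downFrom)
import Data.List as List
open import Data.List.Properties using (++-assoc; filter-++; filter-none; filter-accept)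
import Data.List.Relation.Binary.Lex.Strict as ListLex
import Data.List.Relation.Binary.Pointwise as ListPW
open import Data.List.Membership.Propositional using (_∈_; _∉_)
open import Data.List.Membership.Propositional.Properties
  using ( ∈-++⁺ˡ; ∈-++⁺ʳ; ∈-++⁻; ∈-map⁺; ∈-map⁻; ∈-concat⁺′; ∈-filter⁺; ∈-filter⁻; ∈-lookup
        ; ∈-downFrom⁺; ∈-downFrom⁻)
open import Data.List.Relation.Unary.Any using (here; there; index)
open import Data.List.Relation.Unary.Any.Properties using (lookup-index)
open import Data.List.Relation.Unary.All using (All; []; _∷_)
import Data.List.Relation.Unary.All as All
import Data.List.Relation.Unary.All.Properties as AllP
open import Data.List.Relation.Unary.AllPairs using (AllPairs; []; _∷_)
import Data.List.Relation.Unary.AllPairs as AllPairs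
import Data.List.Relation.Unary.AllPairs.Properties as AllPairsP
open import Data.List.Relation.Unary.Linked using (Linked; []; [-]; _∷_)
import Data.List.Relation.Unary.Linked as Linked
open import Data.List.Relation.Unary.Linked.Properties using (Linked⇒AllPairs; AllPairs⇒Linked)
open import Relation.Binary.Core using (Rel)
open import Relation.Binary.Structures using (IsEquivalence)
open import Relation.Binary.Definitions
  using (DecidableEquality; Decidable; Reflexive; Transitive; Antisymmetric; tri<; tri≈; tri>)
open import Relation.Binary.PropositionalEquality hiding ([_])
open import Relation.Nullary using (¬_; Dec; yes; no; contradiction)
open import Relation.Nullary.Decidable using (_⊎-dec_; _×-dec_; decidable-stable)

private
  variable
    k : ℕ
    u v w : Vec ℕ k

≤v-refl : u ≤v u
≤v-refl = PW.refl ≤-refl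

≤v-trans : u ≤v v → v ≤v w → u ≤v w
≤v-trans = PW.trans ≤-trans

≤v-antisym : u ≤v v → v ≤v u → u ≡ v
≤v-antisym [] [] = refl
≤v-antisym (p ∷ ps) (q ∷ qs) = cong₂ _∷_ (≤-antisym p q) (≤v-antisym ps qs)

_≤v?_ : (u v : Vec ℕ k) → Dec (u ≤v v)
_≤v?_ = PW.decidable _≤?_

𝟎≤v : (u : Vec ℕ k) → 𝟎 k ≤v u
𝟎≤v [] = []
𝟎≤v (_ ∷ u) = z≤n ∷ 𝟎≤v u

sum-𝟎 : ∀ k → sum (𝟎 k) ≡ 0
sum-𝟎 zero = refl
sum-𝟎 (suc k) = sum-𝟎 k

sum-mono-≤v : u ≤v v → sum u ≤ sum v
sum-mono-≤v [] = z≤n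
sum-mono-≤v (p ∷ ps) = +-mono-≤ p (sum-mono-≤v ps)

≤v∧sum≡⇒≡ : u ≤v v → sum u ≡ sum v → u ≡ v
≤v∧sum≡⇒≡ [] _ = refl
≤v∧sum≡⇒≡ {u = x ∷ _} (p ∷ ps) e with m≤n⇒m<n∨m≡n p
... | inj₁ x<y = contradiction e (<⇒≢ (+-mono-<-≤ x<y (sum-mono-≤v ps)))
... | inj₂ refl = cong (x ∷_) (≤v∧sum≡⇒≡ ps (+-cancelˡ-≡ x _ _ e))

≤v∧≢⇒sum< : u ≤v v → u ≢ v → sum u < sum v
≤v∧≢⇒sum< u≤v u≢v = ≤∧≢⇒< (sum-mono-≤v u≤v) (u≢v ∘ ≤v∧sum≡⇒≡ u≤v)

≤v-step-up : u ≤v v → sum u < sum v → ∃[ w ] u ≤v w × w ≤v v × sum w ≡ suc (sum u)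
≤v-step-up {u = x ∷ u} (p ∷ ps) lt with m≤n⇒m<n∨m≡n p
... | inj₁ x<y = suc x ∷ u , n≤1+n x ∷ ≤v-refl , x<y ∷ ps , refl
... | inj₂ refl with w , u≤w , w≤v , e ← ≤v-step-up ps (+-cancelˡ-< x _ _ lt)
  = x ∷ w , ≤-refl ∷ u≤w , ≤-refl ∷ w≤v , trans (cong (x +_) e) (+-suc x (sum u))

≤v-step-down : u ≤v v → sum u < sum v → ∃[ w ] u ≤v w × w ≤v v × suc (sum w) ≡ sum v
≤v-step-down {v = zero ∷ _} (z≤n ∷ ps) lt with w , u≤w , w≤v , e ← ≤v-step-down ps lt
  = 0 ∷ w , z≤n ∷ u≤w , z≤n ∷ w≤v , e
≤v-step-down {v = suc y ∷ v} (p ∷ ps) lt with m≤n⇒m<n∨m≡n p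
... | inj₁ (s≤s x≤y) = y ∷ v , x≤y ∷ ps , n≤1+n y ∷ ≤v-refl , refl
... | inj₂ refl with w , u≤w , w≤v , e ← ≤v-step-down ps (+-cancelˡ-< (suc y) _ _ lt)
  = suc y ∷ w , ≤-refl ∷ u≤w , ≤-refl ∷ w≤v
  , trans (sym (+-suc (suc y) (sum w))) (cong (suc y +_) e)

≤v-interpolate : ∀ s → u ≤v v → sum u + s ≤ sum v →
                 ∃[ w ] u ≤v w × w ≤v v × sum w ≡ sum u + s
≤v-interpolate {u = u} zero u≤v _ = u , ≤v-refl , u≤v , sym (+-identityʳ _)
≤v-interpolate {u = u} {v = v} (suc s) u≤v le
  with w , u≤w , w≤v , e ← ≤v-interpolate s u≤v (≤-trans (+-monoʳ-≤ (sum u) (n≤1+n s)) le)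
  with w′ , w≤w′ , w′≤v , e′ ← ≤v-step-up w≤v
         (subst (_< sum v) (sym e) (subst (_≤ sum v) (+-suc (sum u) s) le))
  = w′ , ≤v-trans u≤w w≤w′ , w′≤v , trans e′ (trans (cong suc e) (sym (+-suc (sum u) s)))

-- The reverse lexicographic order and the exchange step

_⊏_ : Rel (Vec ℕ k) _
_⊏_ = VecLex.Lex-< _≡_ _>_

⊏-irrefl : ¬ u ⊏ u
⊏-irrefl = VecLex.<-irrefl (λ x≡y → <-irrefl (sym x≡y)) (PW.refl refl)

⊏-trans : u ⊏ v → v ⊏ w → u ⊏ w
⊏-trans = VecLex.<-trans (IsEquivalence.isPartialEquivalence isEquivalence) (resp₂ _>_)
                         (flip <-trans)

⊏⇒≢ : u ⊏ v → u ≢ v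
⊏⇒≢ u⊏v refl = ⊏-irrefl u⊏v

SlackAfter : Fin k → Vec ℕ k → Vec ℕ k → Set
SlackAfter zero    (_ ∷ p) (_ ∷ u) = sum p < sum u
SlackAfter (suc i) (_ ∷ p) (_ ∷ u) = SlackAfter i p u

SlackUpTo : Fin k → Vec ℕ k → Vec ℕ k → Set
SlackUpTo zero    (x ∷ _) (y ∷ _) = x < y
SlackUpTo (suc i) (x ∷ u) (y ∷ v) = x < y ⊎ SlackUpTo i u v

slackUpTo? : (i : Fin k) (u v : Vec ℕ k) → Dec (SlackUpTo i u v)
slackUpTo? zero    (x ∷ _) (y ∷ _) = x <? y
slackUpTo? (suc i) (x ∷ u) (y ∷ v) = x <? y ⊎-dec slackUpTo? i u v

slackAfter⇒sum< : ∀ i {p u : Vec ℕ k} → p ≤v u → SlackAfter i p u → sum p < sum u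
slackAfter⇒sum< zero    (x≤y ∷ _)   slack = +-mono-≤-< x≤y slack
slackAfter⇒sum< (suc i) (x≤y ∷ p≤u) slack = +-mono-≤-< x≤y (slackAfter⇒sum< i p≤u slack)

¬slackUpTo⇒slackAfter : ∀ i → u ≤v v → ¬ SlackUpTo i u v → sum u < sum v →
                        SlackAfter i u v × lookup v i ≡ lookup u i
¬slackUpTo⇒slackAfter {u = x ∷ _} zero (p ∷ _) ¬slack lt with m≤n⇒m<n∨m≡n p
... | inj₁ x<y = contradiction x<y ¬slack
... | inj₂ refl = +-cancelˡ-< x _ _ lt , refl
¬slackUpTo⇒slackAfter {u = x ∷ _} (suc i) (p ∷ ps) ¬slack lt with m≤n⇒m<n∨m≡n p
... | inj₁ x<y = contradiction (inj₁ x<y) ¬slack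
... | inj₂ refl = ¬slackUpTo⇒slackAfter i ps (¬slack ∘ inj₂) (+-cancelˡ-< x _ _ lt)

shift-unit-to-head : ∀ {a b c} {p u v : Vec ℕ k} →
  a ≤ b → b < c → p ≤v u → u ≤v v → sum p < sum u →
  ∃[ u′ ] (a ∷ p) ≤v u′ × u′ ≤v (c ∷ v) × sum u′ ≡ sum (b ∷ u) × u′ ⊏ (b ∷ u)
shift-unit-to-head {b = b} a≤b b<c p≤u u≤v lt with w , p≤w , w≤u , e ← ≤v-step-down p≤u lt
  = suc b ∷ w , m≤n⇒m≤1+n a≤b ∷ p≤w , b<c ∷ ≤v-trans w≤u u≤v
  , trans (sym (+-suc b (sum w))) (cong (b +_) e) , VecLex.this (n<1+n b) refl

-- A unit of u moves from beyond coordinate j to the first coordinate j ≤ i where u < v.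
⊏-exchange : ∀ i {p : Vec ℕ k} → p ≤v u → u ≤v v → SlackAfter i p u → SlackUpTo i u v →
             ∃[ u′ ] p ≤v u′ × u′ ≤v v × sum u′ ≡ sum u × u′ ⊏ u
⊏-exchange zero (a≤b ∷ p≤u) (_ ∷ u≤v) slack b<c = shift-unit-to-head a≤b b<c p≤u u≤v slack
⊏-exchange (suc i) (a≤b ∷ p≤u) (_ ∷ u≤v) slack (inj₁ b<c) =
  shift-unit-to-head a≤b b<c p≤u u≤v (slackAfter⇒sum< i p≤u slack)
⊏-exchange {u = b ∷ _} (suc i) (a≤b ∷ p≤u) (b≤c ∷ u≤v) slack (inj₂ lo)
  with u′ , p≤u′ , u′≤v , e , u′⊏u ← ⊏-exchange i p≤u u≤v slack lo
  = b ∷ u′ , a≤b ∷ p≤u′ , b≤c ∷ u′≤v , cong (b +_) e , VecLex.next refl u′⊏u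

<-balance : ∀ {x x′ y y′} → x < x′ → x + y ≡ x′ + y′ → y′ < y
<-balance {x} {y = y} {y′} x<x′ e =
  +-cancelˡ-< x y′ y (subst (x + y′ <_) (sym e) (+-monoˡ-< y′ x<x′))

first-difference : ∀ {a b b′ : Vec ℕ k} → a ≤v b → a ≤v b′ → sum b ≡ sum b′ → b′ ⊏ b →
                   ∃[ i ] SlackAfter i a b × lookup b i < lookup b′ i
first-difference (_ ∷ a≤b) (_ ∷ a≤b′) e (VecLex.this b₀<b′₀ _) =
  zero , ≤-<-trans (sum-mono-≤v a≤b′) (<-balance b₀<b′₀ e) , b₀<b′₀
first-difference (_ ∷ a≤b) (_ ∷ a≤b′) e (VecLex.next refl b′⊏b)
  with i , slack , lt ← first-difference a≤b a≤b′ (+-cancelˡ-≡ _ _ _ e) b′⊏b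
  = suc i , slack , lt

∣-<⇒+≤ : ∀ {m x y} → m ∣ x → m ∣ y → x < y → x + m ≤ y
∣-<⇒+≤ {m} (divides p refl) (divides q refl) pm<qm =
  subst (_≤ q * m) (+-comm m (p * m)) (*-monoˡ-≤ m (*-cancelʳ-< m p q pm<qm))

module _ {a ℓ} {A : Set a} {R : Rel A ℓ} where

  AllPairs-lookup : ∀ {xs} → AllPairs R xs → ∀ {i j : Fin (length xs)} → i <ᶠ j →
                    R (List.lookup xs i) (List.lookup xs j)
  AllPairs-lookup (Rx ∷ _)  {zero}  {suc j} _         = All.lookup Rx (∈-lookup j)
  AllPairs-lookup (_ ∷ Rxs) {suc i} {suc j} (s≤s i<j) = AllPairs-lookup Rxs i<j

  AllPairs-∉ : (∀ {x} → ¬ R x x) → ∀ P {w Q} → AllPairs R (P ++ w ∷ Q) → w ∉ P × w ∉ Q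
  AllPairs-∉ irrefl [] (Rw ∷ _) = (λ ()) , λ w∈Q → irrefl (All.lookup Rw w∈Q)
  AllPairs-∉ irrefl (x ∷ P) (Rx ∷ Rxs) with w∉P , w∉Q ← AllPairs-∉ irrefl P Rxs
    = (λ { (here refl) → irrefl (All.lookup Rx (∈-++⁺ʳ P (here refl)))
         ; (there w∈P) → w∉P w∈P })
    , w∉Q

  AllPairs-concatMap : ∀ {b ℓ′} {B : Set b} {S : Rel B ℓ′} (f : B → List A) {xs} →
    AllPairs S xs → (∀ x → AllPairs R (f x)) →
    (∀ {x y} → S x y → All (λ p → All (R p) (f y)) (f x)) → AllPairs R (concatMap f xs)
  AllPairs-concatMap f Sxs within across = AllPairsP.concat⁺
    (AllP.map⁺ (All.tabulate λ {x} _ → within x)) (AllPairsP.map⁺ (AllPairs.map across Sxs))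

module _ {a ℓ} {A : Set a} {_<_ : Rel A ℓ}
         (<-irrefl : ∀ {x} → ¬ x < x) (<-trans : Transitive _<_) where

  sorted-exchange⇒indexed : ∀ {p} (G : A → A → A → Set p) L → AllPairs _<_ L →
    (∀ {c c′} → c ∈ L → c′ ∈ L → c′ < c → ∃[ c* ] c* ∈ L × c* < c × G c c′ c*) →
    ∀ (i j : Fin (length L)) → i <ᶠ j →
    ∃[ k ] k <ᶠ j × G (List.lookup L j) (List.lookup L i) (List.lookup L k)
  sorted-exchange⇒indexed G L sorted exchange i j i<j
    with c* , c*∈L , c*<c , g ← exchange (∈-lookup j) (∈-lookup i) (AllPairs-lookup sorted i<j)
    with k ← index c*∈L | refl ← lookup-index c*∈L | Fin.<-cmp k j
  ... | tri< k<j _ _ = k , k<j , g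
  ... | tri≈ _ refl _ = contradiction c*<c <-irrefl
  ... | tri> _ _ j<k = contradiction (<-trans c*<c (AllPairs-lookup sorted j<k)) <-irrefl

∈-replace : ∀ {a} {A : Set a} P {Q} {x w w′ : A} →
            x ∈ P ++ w ∷ Q → x ≢ w → x ∈ P ++ w′ ∷ Q
∈-replace P x∈ x≢w with ∈-++⁻ P x∈
... | inj₁ x∈P = ∈-++⁺ˡ x∈P
... | inj₂ (here x≡w) = contradiction x≡w x≢w
... | inj₂ (there x∈Q) = ∈-++⁺ʳ P (there x∈Q)

module _ {a} {A : Set a} (_≟_ : DecidableEquality A) where

  open import Data.List.Membership.DecPropositional _≟_ using (_∉?_)

  _∖_ : List A → List A → List A
  xs ∖ ys = filter (λ x → x ∉? ys) xs

  ∖-single : ∀ P {Q Y} {w} → All (_∈ Y) P → All (_∈ Y) Q → w ∉ Y → (P ++ w ∷ Q) ∖ Y ≡ [ w ]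
  ∖-single P {Q} {Y} {w} P⊆Y Q⊆Y w∉Y = begin
    filter (_∉? Y) (P ++ w ∷ Q)       ≡⟨ filter-++ (_∉? Y) P (w ∷ Q) ⟩
    P ∖ Y ++ filter (_∉? Y) (w ∷ Q)  ≡⟨ cong₂ _++_ (none P⊆Y) (filter-accept (_∉? Y) w∉Y) ⟩
    w ∷ Q ∖ Y                        ≡⟨ cong (w ∷_) (none Q⊆Y) ⟩
    [ w ]                            ∎
    where
    open ≡-Reasoning
    none : ∀ {X} → All (_∈ Y) X → X ∖ Y ≡ []
    none = filter-none (_∉? Y) ∘ All.map (λ x∈Y x∉Y → x∉Y x∈Y)

  symDiff-replace : ∀ P Q {w w′} → w ∉ P → w ∉ Q → w′ ∉ P → w′ ∉ Q → w ≢ w′ →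
    length ((P ++ w ∷ Q) ∖ (P ++ w′ ∷ Q) ++ (P ++ w′ ∷ Q) ∖ (P ++ w ∷ Q)) ≡ 2
  symDiff-replace P Q w∉P w∉Q w′∉P w′∉Q w≢w′ = cong₂ (λ xs ys → length (xs ++ ys))
    (∖-single P ⊆P ⊆Q (∉-replaced w∉P w∉Q w≢w′))
    (∖-single P ⊆P ⊆Q (∉-replaced w′∉P w′∉Q (w≢w′ ∘ sym)))
    where
    ⊆P : ∀ {x} → All (_∈ P ++ x ∷ Q) P
    ⊆P = All.tabulate ∈-++⁺ˡ
    ⊆Q : ∀ {x} → All (_∈ P ++ x ∷ Q) Q
    ⊆Q = All.tabulate (∈-++⁺ʳ P ∘ there)
    ∉-replaced : ∀ {x y} → x ∉ P → x ∉ Q → x ≢ y → x ∉ P ++ y ∷ Q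
    ∉-replaced x∉P x∉Q x≢y x∈ with ∈-++⁻ P x∈
    ... | inj₁ x∈P = x∉P x∈P
    ... | inj₂ (here x≡y) = x≢y x≡y
    ... | inj₂ (there x∈Q) = x∉Q x∈Q

downFrom-sorted : ∀ n → AllPairs _>_ (downFrom n)
downFrom-sorted zero = []
downFrom-sorted (suc n) = All.tabulate ∈-downFrom⁻ ∷ downFrom-sorted n

below : Vec ℕ k → List (Vec ℕ k)
below []       = [ [] ]
below (y ∷ ys) = concatMap (λ x → map (x ∷_) (below ys)) (downFrom (suc y))

∈-below : u ≤v v → u ∈ below v
∈-below [] = here refl
∈-below {u = x ∷ _} {v = y ∷ ys} (x≤y ∷ u≤v) = ∈-concat⁺′ (∈-map⁺ (x ∷_) (∈-below u≤v))
  (∈-map⁺ (λ x → map (x ∷_) (below ys)) (∈-downFrom⁺ (s≤s x≤y)))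

below-sorted : (v : Vec ℕ k) → AllPairs _⊏_ (below v)
below-sorted [] = [] ∷ []
below-sorted (y ∷ ys) =
  AllPairs-concatMap (λ x → map (x ∷_) (below ys)) (downFrom-sorted (suc y))
    (λ _ → AllPairsP.map⁺ (AllPairs.map (VecLex.next refl) (below-sorted ys)))
    (λ x>x′ → AllP.map⁺ (All.tabulate λ _ → AllP.map⁺ (All.tabulate λ _ → VecLex.this x>x′ refl)))

-- Maximal chains in a poset

module MaximalChains {a ℓ₁ ℓ₂} {A : Set a} (_≟_ : DecidableEquality A) (Elem : A → Set ℓ₁)
  {_≼_ : Rel A ℓ₂} (_≼?_ : Decidable _≼_)
  (≼-refl : Reflexive _≼_) (≼-trans : Transitive _≼_) (≼-antisym : Antisymmetric _≡_ _≼_) where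

  open Shelling _≟_ Elem _≼_
  open import Data.List.Membership.DecPropositional _≟_ using (_∈?_)

  ≺-irrefl : ∀ {x} → ¬ x ≺ x
  ≺-irrefl (_ , x≢x) = x≢x refl

  ≺-trans : Transitive _≺_
  ≺-trans (x≼y , x≢y) (y≼z , _) = ≼-trans x≼y y≼z , λ { refl → x≢y (≼-antisym x≼y y≼z) }

  chain-sorted : ∀ {c} → IsChain c → AllPairs _≺_ c
  chain-sorted = Linked⇒AllPairs ≺-trans ∘ proj₂

  chain-comparable : ∀ {c x y} → IsChain c → x ∈ c → y ∈ c → x ≼ y ⊎ y ≼ x
  chain-comparable chain = compare (chain-sorted chain)
    where
    compare : ∀ {c x y} → AllPairs _≺_ c → x ∈ c → y ∈ c → x ≼ y ⊎ y ≼ x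
    compare (_ ∷ _)      (here refl) (here refl) = inj₁ ≼-refl
    compare (x≺ ∷ _)     (here refl) (there y∈) = inj₁ (proj₁ (All.lookup x≺ y∈))
    compare (y≺ ∷ _)     (there x∈)  (here refl) = inj₂ (proj₁ (All.lookup y≺ x∈))
    compare (_ ∷ sorted) (there x∈)  (there y∈) = compare sorted x∈ y∈

  chain-head-minimal : ∀ {h t x} → AllPairs _≺_ (h ∷ t) → x ∈ h ∷ t → x ≼ h → x ≡ h
  chain-head-minimal _ (here x≡h) _ = x≡h
  chain-head-minimal (h≺t ∷ _) (there x∈t) x≼h with h≼x , h≢x ← All.lookup h≺t x∈t
    = contradiction (sym (≼-antisym x≼h h≼x)) h≢x

  private
    insert : A → List A → List A
    insert w [] = [ w ]
    insert w (y ∷ ys) with w ≼? y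
    ... | yes _ = w ∷ y ∷ ys
    ... | no _  = y ∷ insert w ys

    ∈-insert : ∀ w ys → w ∈ insert w ys
    ∈-insert w [] = here refl
    ∈-insert w (y ∷ ys) with w ≼? y
    ... | yes _ = here refl
    ... | no _  = there (∈-insert w ys)

    insert-⊇ : ∀ w ys {x} → x ∈ ys → x ∈ insert w ys
    insert-⊇ w (y ∷ ys) x∈ with w ≼? y
    insert-⊇ w (y ∷ ys) x∈         | yes _ = there x∈
    insert-⊇ w (y ∷ ys) (here x≡y) | no _  = here x≡y
    insert-⊇ w (y ∷ ys) (there x∈) | no _  = there (insert-⊇ w ys x∈)

    insert-All : ∀ {p} {P : A → Set p} w ys → P w → All P ys → All P (insert w ys)
    insert-All w [] Pw [] = Pw ∷ []
    insert-All w (y ∷ ys) Pw (Py ∷ Pys) with w ≼? y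
    ... | yes _ = Pw ∷ Py ∷ Pys
    ... | no _  = Py ∷ insert-All w ys Pw Pys

    insert-sorted : ∀ w ys → w ∉ ys → (∀ {y} → y ∈ ys → y ≼ w ⊎ w ≼ y) →
                    AllPairs _≺_ ys → AllPairs _≺_ (insert w ys)
    insert-sorted w [] _ _ _ = [] ∷ []
    insert-sorted w (y ∷ ys) w∉ comparable (y≺ys ∷ sorted) with w ≼? y
    ... | yes w≼y = (w≺y ∷ All.map (≺-trans w≺y) y≺ys) ∷ y≺ys ∷ sorted
      where w≺y = w≼y , w∉ ∘ here
    ... | no w⋠y with comparable (here refl)
    ...   | inj₂ w≼y = contradiction w≼y w⋠y
    ...   | inj₁ y≼w = insert-All w ys (y≼w , w∉ ∘ here ∘ sym) y≺ys
                     ∷ insert-sorted w ys (w∉ ∘ there) (comparable ∘ there) sorted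

  maximal-∋ : ∀ {c w} → IsMaxChain c → Elem w → (∀ {y} → y ∈ c → y ≼ w ⊎ w ≼ y) → w ∈ c
  maximal-∋ {c} {w} ((elems , linked) , maximal) w∈E comparable with w ∈? c
  ... | yes w∈c = w∈c
  ... | no w∉c = maximal (insert w c) (insert-All w c w∈E elems , AllPairs⇒Linked sorted)
                         (insert-⊇ w c) (∈-insert w c)
    where sorted = insert-sorted w c w∉c comparable (Linked⇒AllPairs ≺-trans linked)

  between-consecutive : ∀ pre {x y t w} → AllPairs _≺_ (pre ++ x ∷ y ∷ t) → x ≺ w → w ≺ y →
                        ∀ {q} → q ∈ pre ++ x ∷ y ∷ t → q ≺ w ⊎ w ≺ q
  between-consecutive [] _ x≺w _ (here refl) = inj₁ x≺w
  between-consecutive [] _ _ w≺y (there (here refl)) = inj₂ w≺y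
  between-consecutive [] (_ ∷ y≺t ∷ _) _ w≺y (there (there q∈t)) =
    inj₂ (≺-trans w≺y (All.lookup y≺t q∈t))
  between-consecutive (p ∷ pre) (p≺ ∷ _) x≺w _ (here refl) =
    inj₁ (≺-trans (All.lookup p≺ (∈-++⁺ʳ pre (here refl))) x≺w)
  between-consecutive (p ∷ pre) (_ ∷ sorted) x≺w w≺y (there q∈) =
    between-consecutive pre sorted x≺w w≺y q∈

  NothingBetween : A → A → Set _
  NothingBetween x y = ∀ {w} → Elem w → x ≺ w → ¬ w ≺ y

  maximal-saturated : ∀ {c} → IsMaxChain c → Linked NothingBetween c
  maximal-saturated = go []
    where
    go : ∀ pre {s} → IsMaxChain (pre ++ s) → Linked NothingBetween s
    go pre {[]} _ = []
    go pre {x ∷ []} _ = [-]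
    go pre {x ∷ y ∷ t} max =
      nothing-between ∷ go (pre ++ [ x ]) (subst IsMaxChain (sym (++-assoc pre [ x ] (y ∷ t))) max)
      where
      nothing-between : NothingBetween x y
      nothing-between w∈E x≺w w≺y =
        [ ≺-irrefl , ≺-irrefl ]′ (between (maximal-∋ max w∈E (Sum.map proj₁ proj₁ ∘ between)))
        where between = between-consecutive pre (chain-sorted (proj₁ max)) x≺w w≺y

-- The interval [0, z] in V_{m,n}

module Interval (m n : ℕ) (m≥1 : 1 ≤ m) (z : Vec ℕ n) (m∣z : m ∣ sum z) where

  V : Set
  V = Vec ℕ n

  _≟ᵥ_ : DecidableEquality V
  _≟ᵥ_ = ≡-dec _≟_

  open Shelling _≟ᵥ_ (InInterval m n z) _≤v_
  open MaximalChains _≟ᵥ_ (InInterval m n z) _≤v?_ ≤v-refl ≤v-trans ≤v-antisym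

  m∣𝟎 : m ∣ sum (𝟎 n)
  m∣𝟎 = divides 0 (sum-𝟎 n)

  _⋖_ : V → V → Set
  a ⋖ b = a ≤v b × sum b ≡ sum a + m

  _⋖?_ : Decidable _⋖_
  a ⋖? b = a ≤v? b ×-dec sum b ≟ sum a + m

  ⋖⇒sum< : ∀ {a b} → a ⋖ b → sum a < sum b
  ⋖⇒sum< {a} (_ , e) = subst (sum a <_) (sym e) (m<m+n (sum a) m≥1)

  ⋖⇒≺ : ∀ {a b} → a ⋖ b → a ≺ b
  ⋖⇒≺ a⋖b = proj₁ a⋖b , λ { refl → <-irrefl refl (⋖⇒sum< a⋖b) }

  ⋖-preserves-m∣ : ∀ {a b} → a ⋖ b → m ∣ sum a → m ∣ sum b
  ⋖-preserves-m∣ (_ , e) m∣a = subst (m ∣_) (sym e) (∣m∣n⇒∣m+n m∣a ∣-refl)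

  -- Climb k a t: a ∷ t is a maximal chain of [a, z] with k steps (t omits a).
  data Climb : ℕ → V → List V → Set where
    end  : Climb 0 z []
    step : ∀ {k a b t} → a ⋖ b → Climb k b t → Climb (suc k) a (b ∷ t)

  climb-≤z : ∀ {k a t} → Climb k a t → a ≤v z
  climb-≤z end = ≤v-refl
  climb-≤z (step a⋖b climb) = ≤v-trans (proj₁ a⋖b) (climb-≤z climb)

  climb-above : ∀ {k a t} → Climb k a t → All (a ≤v_) (a ∷ t)
  climb-above end = ≤v-refl ∷ []
  climb-above (step a⋖b climb) = ≤v-refl ∷ All.map (≤v-trans (proj₁ a⋖b)) (climb-above climb)

  climb-covering : ∀ {k a t} → Climb k a t → Linked _⋖_ (a ∷ t)
  climb-covering end = [-]
  climb-covering (step a⋖b climb) = a⋖b ∷ climb-covering climb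

  climb-sorted : ∀ {k a t} → Climb k a t → AllPairs _≺_ (a ∷ t)
  climb-sorted = Linked⇒AllPairs ≺-trans ∘ Linked.map ⋖⇒≺ ∘ climb-covering

  climb-∌-start : ∀ {k a t} → Climb k a t → a ∉ t
  climb-∌-start = proj₂ ∘ AllPairs-∉ ≺-irrefl [] ∘ climb-sorted

  climb-elements : ∀ {k a t} → m ∣ sum a → Climb k a t → All (InInterval m n z) (a ∷ t)
  climb-elements m∣a end = (m∣a , 𝟎≤v z , ≤v-refl) ∷ []
  climb-elements {a = a} m∣a climb@(step a⋖b rest) =
    (m∣a , 𝟎≤v a , climb-≤z climb) ∷ climb-elements (⋖-preserves-m∣ a⋖b m∣a) rest

  climb-sum : ∀ {k a t} → Climb k a t → sum z ≡ sum a + k * m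
  climb-sum end = sym (+-identityʳ _)
  climb-sum {suc k} {a} (step (_ , e) climb) = begin
    sum z              ≡⟨ climb-sum climb ⟩
    _ + k * m          ≡⟨ cong (_+ k * m) e ⟩
    sum a + m + k * m  ≡⟨ +-assoc (sum a) m (k * m) ⟩
    sum a + suc k * m  ∎
    where open ≡-Reasoning

  climb-absorbs : ∀ {k a t x} → Climb k a t → m ∣ sum a → InInterval m n z x → a ≤v x →
                  (∀ {y} → y ∈ t → y ≤v x ⊎ x ≤v y) → x ∈ a ∷ t
  climb-absorbs end _ (_ , _ , x≤z) z≤x _ = here (≤v-antisym x≤z z≤x)
  climb-absorbs {a = a} {x = x} (step {b = b} a⋖b climb) m∣a x∈I@(m∣x , _ , _) a≤x comparable
    with comparable (here refl) | x ≟ᵥ a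
  ... | inj₁ b≤x | _ =
    there (climb-absorbs climb (⋖-preserves-m∣ a⋖b m∣a) x∈I b≤x (comparable ∘ there))
  ... | inj₂ _ | yes x≡a = here x≡a
  ... | inj₂ x≤b | no x≢a = there (here (≤v∧sum≡⇒≡ x≤b (≤-antisym (sum-mono-≤v x≤b) b≤x)))
    where
    b≤x : sum b ≤ sum x
    b≤x = subst (_≤ sum x) (sym (proj₂ a⋖b)) (∣-<⇒+≤ m∣a m∣x (≤v∧≢⇒sum< a≤x (x≢a ∘ sym)))

  climb⇒maximal : ∀ {k t} → Climb k (𝟎 n) t → IsMaxChain (𝟎 n ∷ t)
  climb⇒maximal climb = chain , maximal
    where
    chain : IsChain (𝟎 n ∷ _)
    chain = climb-elements m∣𝟎 climb , Linked.map ⋖⇒≺ (climb-covering climb)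
    maximal : ∀ c′ → IsChain c′ → (∀ {x} → x ∈ 𝟎 n ∷ _ → x ∈ c′) → ∀ {x} → x ∈ c′ → x ∈ 𝟎 n ∷ _
    maximal c′ chain′ ⊆c′ x∈c′ =
      climb-absorbs climb m∣𝟎 (All.lookup (proj₁ chain′) x∈c′) (𝟎≤v _)
        (λ y∈t → chain-comparable chain′ (⊆c′ (there y∈t)) x∈c′)

  ¬⋖⇒between : ∀ {x y} → InInterval m n z x → InInterval m n z y → x ≺ y → ¬ x ⋖ y →
               ∃[ w ] InInterval m n z w × x ≺ w × w ≺ y
  ¬⋖⇒between {x} (m∣x , _ , _) (m∣y , _ , y≤z) (x≤y , x≢y) x⋪y
    with w , x≤w , w≤y , e ← ≤v-interpolate m x≤y (∣-<⇒+≤ m∣x m∣y (≤v∧≢⇒sum< x≤y x≢y))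
    = w , (⋖-preserves-m∣ (x≤w , e) m∣x , 𝟎≤v w , ≤v-trans w≤y y≤z)
        , (x≤w , λ { refl → <-irrefl e (m<m+n (sum x) m≥1) })
        , (w≤y , λ { refl → x⋪y (x≤y , e) })

  maximal-covering : ∀ {c} → IsMaxChain c → Linked _⋖_ c
  maximal-covering max@((elems , linked) , _) = covering elems linked (maximal-saturated max)
    where
    covering : ∀ {c} → All (InInterval m n z) c → Linked _≺_ c → Linked NothingBetween c →
               Linked _⋖_ c
    covering _ [] [] = []
    covering _ [-] [-] = [-]
    covering (x∈I ∷ y∈I ∷ elems) (x≺y ∷ linked) (gap ∷ gaps) =
      decidable-stable (_ ⋖? _) (λ x⋪y → let w , w∈I , x≺w , w≺y = ¬⋖⇒between x∈I y∈I x≺y x⋪y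
                                          in gap w∈I x≺w w≺y)
      ∷ covering (y∈I ∷ elems) linked gaps

  covering⇒climb : ∀ {x t} → Linked _⋖_ (x ∷ t) → All (_≤v z) t → z ∈ x ∷ t →
                   ∃[ k ] Climb k x t
  covering⇒climb [-] _ (here refl) = 0 , end
  covering⇒climb (x⋖y ∷ _) (y≤z ∷ _) (here refl) =
    contradiction (≤v-antisym (proj₁ x⋖y) y≤z) (proj₂ (⋖⇒≺ x⋖y))
  covering⇒climb (x⋖y ∷ covering) (_ ∷ t≤z) (there z∈)
    with k , climb ← covering⇒climb covering t≤z z∈
    = suc k , step x⋖y climb

  K : ℕ
  K = _∣_.quotient m∣z

  climb-length : ∀ {k t} → Climb k (𝟎 n) t → k ≡ K
  climb-length {k} climb = *-cancelʳ-≡ k K m {{>-nonZero m≥1}} (begin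
    k * m              ≡⟨ cong (_+ k * m) (sum-𝟎 n) ⟨
    sum (𝟎 n) + k * m  ≡⟨ climb-sum climb ⟨
    sum z              ≡⟨ _∣_.equality m∣z ⟩
    K * m              ∎)
    where open ≡-Reasoning

  module _ {c} (max : IsMaxChain c) where

    maximal-∋𝟎 : 𝟎 n ∈ c
    maximal-∋𝟎 = maximal-∋ max (m∣𝟎 , ≤v-refl , 𝟎≤v z) (λ _ → inj₂ (𝟎≤v _))

    maximal-∋z : z ∈ c
    maximal-∋z = maximal-∋ max (m∣z , 𝟎≤v z , ≤v-refl)
                               (λ y∈c → inj₁ (proj₂ (proj₂ (All.lookup (proj₁ (proj₁ max)) y∈c))))

  maximal⇒climb : ∀ {c} → IsMaxChain c → ∃[ t ] c ≡ 𝟎 n ∷ t × Climb K (𝟎 n) t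
  maximal⇒climb {[]} max = contradiction (maximal-∋𝟎 max) λ ()
  maximal⇒climb {h ∷ t} max@((_ ∷ t∈I , _) , _)
    with refl ← chain-head-minimal (chain-sorted (proj₁ max)) (maximal-∋𝟎 max) (𝟎≤v h)
    with k , climb ← covering⇒climb (maximal-covering max) (All.map (proj₂ ∘ proj₂) t∈I)
                                    (maximal-∋z max)
    = t , refl , subst (λ k → Climb k (𝟎 n) t) (climb-length climb) climb

  _<ᶜ_ : Rel (List V) _
  _<ᶜ_ = ListLex.Lex-< _≡_ _⊏_

  <ᶜ-irrefl : ∀ {c} → ¬ c <ᶜ c
  <ᶜ-irrefl = ListLex.<-irreflexive (λ { refl → ⊏-irrefl }) (ListPW.refl refl)

  <ᶜ-trans : Transitive _<ᶜ_
  <ᶜ-trans = ListLex.<-transitive isEquivalence (resp₂ _⊏_) ⊏-trans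

  record Exchange (k : ℕ) (a : V) (t avoid : List V) : Set where
    constructor exchange
    field
      pre post : List V
      old new : V
      split : t ≡ pre ++ old ∷ post
      climb : Climb k a (pre ++ new ∷ post)
      earlier : (pre ++ new ∷ post) <ᶜ t
      old∉avoid : old ∉ avoid
      new≢old : new ≢ old

  exchange-∷ : ∀ {k a b t X} → a ⋖ b → Exchange k b t X → Exchange (suc k) a (b ∷ t) X
  exchange-∷ {b = b} a⋖b (exchange pre post old new refl climb earlier old∉X new≢old) =
    exchange (b ∷ pre) post old new refl (step a⋖b climb) (ListLex.next refl earlier) old∉X new≢old

  exchange-avoid-start : ∀ {k a t X} → Climb k a t → Exchange k a t X → Exchange k a t (a ∷ X)
  exchange-avoid-start climb (exchange pre post old new refl climb* earlier old∉X new≢old) =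
    exchange pre post old new refl climb* earlier old∉a∷X new≢old
    where
    old∉a∷X : old ∉ _ ∷ _
    old∉a∷X (here refl) = climb-∌-start climb (∈-++⁺ʳ pre (here refl))
    old∉a∷X (there old∈X) = old∉X old∈X

  -- Coordinate i stays below θ along the climb until a step u ⋖ v with slack up to i,
  -- which must occur before z since zᵢ ≥ θ; that u is exchanged.
  exchange-below : ∀ {k p u t X} i θ → Climb (suc k) p (u ∷ t) → SlackAfter i p u →
    lookup u i < θ → θ ≤ lookup z i → All (λ x → θ ≤ lookup x i) X → Exchange (suc k) p (u ∷ t) X
  exchange-below i θ (step _ end) _ u<θ θ≤z _ = contradiction θ≤z (<⇒≱ u<θ)
  exchange-below {u = u} i θ (step p⋖u (step {b = v} u⋖v climb)) slack u<θ θ≤z θ≤X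
    with slackUpTo? i u v
  ... | yes slack-up-to
    with u′ , p≤u′ , u′≤v , e , u′⊏u ← ⊏-exchange i (proj₁ p⋖u) (proj₁ u⋖v) slack slack-up-to
    = exchange [] _ u u′ refl
        (step (p≤u′ , trans e (proj₂ p⋖u)) (step (u′≤v , trans (proj₂ u⋖v) (cong (_+ m) (sym e))) climb))
        (ListLex.this u′⊏u) (AllP.All¬⇒¬Any (All.map (λ { θ≤x refl → <⇒≱ u<θ θ≤x }) θ≤X))
        (⊏⇒≢ u′⊏u)
  ... | no ¬slack-up-to
    with slack′ , vᵢ≡uᵢ ← ¬slackUpTo⇒slackAfter i (proj₁ u⋖v) ¬slack-up-to (⋖⇒sum< u⋖v)
    = exchange-∷ p⋖u
        (exchange-below i θ (step u⋖v climb) slack′ (subst (_< θ) (sym vᵢ≡uᵢ) u<θ) θ≤z θ≤X)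

  earlier-exchange : ∀ {k a t t′} → Climb k a t → Climb k a t′ → t′ <ᶜ t → Exchange k a t t′
  earlier-exchange end end (ListLex.base ())
  earlier-exchange (step a⋖b climb) (step _ climb′) (ListLex.next refl t′<t) =
    exchange-∷ a⋖b (exchange-avoid-start climb (earlier-exchange climb climb′ t′<t))
  earlier-exchange (step a⋖b climb) (step a⋖b′ climb′) (ListLex.this b′⊏b)
    with i , slack , bᵢ<b′ᵢ ← first-difference (proj₁ a⋖b) (proj₁ a⋖b′)
                                (trans (proj₂ a⋖b) (sym (proj₂ a⋖b′))) b′⊏b
    = exchange-below i _ (step a⋖b climb) slack bᵢ<b′ᵢ (PW.lookup (climb-≤z climb′) i)
        (All.map (λ b′≤x → PW.lookup b′≤x i) (climb-above climb′))

  climbs : ℕ → V → List (List V)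
  climbs zero a with a ≟ᵥ z
  ... | yes _ = [ [] ]
  ... | no _  = []
  climbs (suc k) a = concatMap (λ b → map (b ∷_) (climbs k b)) (filter (a ⋖?_) (below z))

  climbs-sound : ∀ k a → All (Climb k a) (climbs k a)
  climbs-sound zero a with a ≟ᵥ z
  ... | yes refl = end ∷ []
  ... | no _     = []
  climbs-sound (suc k) a = AllP.concat⁺ (AllP.map⁺ (All.tabulate {xs = filter (a ⋖?_) (below z)}
    λ b∈ → AllP.map⁺ (All.map (step (proj₂ (∈-filter⁻ (a ⋖?_) {xs = below z} b∈)))
                              (climbs-sound k _))))

  climbs-complete : ∀ {k a t} → Climb k a t → t ∈ climbs k a
  climbs-complete end with z ≟ᵥ z
  ... | yes _   = here refl
  ... | no z≢z = contradiction refl z≢z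
  climbs-complete {suc k} {a} (step {b = b} a⋖b climb) =
    ∈-concat⁺′ (∈-map⁺ (b ∷_) (climbs-complete climb))
      (∈-map⁺ (λ b → map (b ∷_) (climbs k b)) (∈-filter⁺ (a ⋖?_) (∈-below (climb-≤z climb)) a⋖b))

  climbs-sorted : ∀ k a → AllPairs _<ᶜ_ (climbs k a)
  climbs-sorted zero a with a ≟ᵥ z
  ... | yes _ = [] ∷ []
  ... | no _  = []
  climbs-sorted (suc k) a = AllPairs-concatMap (λ b → map (b ∷_) (climbs k b))
    (AllPairsP.filter⁺ (a ⋖?_) (below-sorted z))
    (λ b → AllPairsP.map⁺ (AllPairs.map (ListLex.next refl) (climbs-sorted k b)))
    (λ b⊏b′ → AllP.map⁺ (All.tabulate λ _ → AllP.map⁺ (All.tabulate λ _ → ListLex.this b⊏b′)))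

  maxChains : List (List V)
  maxChains = map (𝟎 n ∷_) (climbs K (𝟎 n))

  maxChains-sorted : AllPairs _<ᶜ_ maxChains
  maxChains-sorted = AllPairsP.map⁺ (AllPairs.map (ListLex.next refl) (climbs-sorted K (𝟎 n)))

  maxChains-maximal : All IsMaxChain maxChains
  maxChains-maximal = AllP.map⁺ (All.map climb⇒maximal (climbs-sound K (𝟎 n)))

  maxChains-complete : ∀ c → IsMaxChain c → c ∈ maxChains
  maxChains-complete c max with t , refl , climb ← maximal⇒climb max =
    ∈-map⁺ (𝟎 n ∷_) (climbs-complete climb)

  ShellingStep : List V → List V → List V → Set
  ShellingStep c c′ c* = (∀ {x} → x ∈ c → x ∈ c′ → x ∈ c*) × length (symDiff c c*) ≡ 2

  exchange⇒shellingStep : ∀ {t t′} → Climb K (𝟎 n) t → Climb K (𝟎 n) t′ → t′ <ᶜ t →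
    ∃[ c* ] c* ∈ maxChains × c* <ᶜ (𝟎 n ∷ t) × ShellingStep (𝟎 n ∷ t) (𝟎 n ∷ t′) c*
  exchange⇒shellingStep climb climb′ t′<t
    with exchange pre post old new refl climb* earlier old∉ new≢old ←
         exchange-avoid-start climb (earlier-exchange climb climb′ t′<t)
    with old∉pre , old∉post ← AllPairs-∉ ≺-irrefl (𝟎 n ∷ pre) (climb-sorted climb)
    with new∉pre , new∉post ← AllPairs-∉ ≺-irrefl (𝟎 n ∷ pre) (climb-sorted climb*)
    = 𝟎 n ∷ pre ++ new ∷ post , ∈-map⁺ (𝟎 n ∷_) (climbs-complete climb*)
    , ListLex.next refl earlier
    , (λ x∈c x∈c′ → ∈-replace (𝟎 n ∷ pre) x∈c λ { refl → old∉ x∈c′ })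
    , symDiff-replace _≟ᵥ_ (𝟎 n ∷ pre) post old∉pre old∉post new∉pre new∉post (new≢old ∘ sym)

  maxChains-shellingStep : ∀ {c c′} → c ∈ maxChains → c′ ∈ maxChains → c′ <ᶜ c →
    ∃[ c* ] c* ∈ maxChains × c* <ᶜ c × ShellingStep c c′ c*
  maxChains-shellingStep c∈ c′∈ c′<c
    with t , t∈ , refl ← ∈-map⁻ (𝟎 n ∷_) c∈
    with t′ , t′∈ , refl ← ∈-map⁻ (𝟎 n ∷_) c′∈
    with c′<c
  ... | ListLex.this 𝟎⊏𝟎 = contradiction 𝟎⊏𝟎 ⊏-irrefl
  ... | ListLex.next refl t′<t =
    exchange⇒shellingStep (All.lookup (climbs-sound K _) t∈) (All.lookup (climbs-sound K _) t′∈) t′<t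

  shellable : Shellable
  shellable = maxChains
    , AllPairs.map (λ c<c′ c≡c′ → <ᶜ-irrefl (subst (_<ᶜ _) c≡c′ c<c′)) maxChains-sorted
    , maxChains-maximal
    , maxChains-complete
    , sorted-exchange⇒indexed <ᶜ-irrefl <ᶜ-trans ShellingStep maxChains maxChains-sorted
                              maxChains-shellingStep

proposition2 : (m n : ℕ) → 1 ≤ m → 1 ≤ n → (z : Vec ℕ n) → InV m n z →
    Shelling.Shellable (≡-dec _≟_) (InInterval m n z) _≤v_
proposition2 m n m≥1 _ z m∣z = Interval.shellable m n m≥1 z m∣z
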